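{- Let $G$ be a finite trivially power-colorable graph, let $\lambda$ be an infinite cardinal, and let $\Phi$ be a proper $\chi(G)$-coloring of $G^{\lambda}$. Then there exist an ultrafilter $\mathscr U$ on $\lambda$ and a $\chi(G)$-coloring $\phi$ of $G$ such that $\Phi=\phi^{\mathscr U}$.
   Context: Graphs are undirected and simple; a $k$-coloring is a proper coloring $V\to k=\{0,\dots,k-1\}$. The direct product $\times_{i\in I}G_i$ has vertex set $\times_i V(G_i)$ with $u,v$ adjacent iff $u_iv_i\in E(G_i)$ for all $i$; $G^I$ (in particular $G^n$, $G^\lambda$) is the product of copies of $G$ indexed by $I$. A coloring $\Phi$ of $\times_{i\in I}G_i$ is trivial if there exist $i^*\in I$ and a coloring $\phi$ of $G_{i^*}$ with $\Phi(v)=\phi(v_{i^*})$ for all $v$. $G$ is trivially power-colorable if for every positive integer $n$, every $\chi(G^n)$-coloring of $G^n$ is trivial. For a finite graph $G$, a map $\phi:V(G)\to k$ and an ultrafilter $\mathscr U$ on $\lambda$, define $\phi^{\mathscr U}:V(G^\lambda)\to k$ by $\phi^{\mathscr U}(\mathbf v)=\phi(\mathbf v_{\mathscr U})$, where for $\mathbf v=(v_\alpha)_{\alpha<\lambda}$, $\mathbf v_{\mathscr U}$ is the unique $w\in V(G)$ with $\{\alpha<\lambda: v_\alpha=w\}\in\mathscr U$. -}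

module Defs where

open import Data.Nat using (ℕ; suc; _≤_)
open import Data.Fin using (Fin; _≟_)
open import Data.Bool using (Bool; true; false; not; _∧_)
open import Data.Product using (Σ; _×_; ∃)
open import Data.Sum using (_⊎_)
open import Relation.Nullary using (¬_; Dec)
open import Relation.Nullary.Decidable using (⌊_⌋)
open import Relation.Binary.PropositionalEquality using (_≡_; _≢_)
open import Function.Bundles using (_↣_)

record FinGraph : Set₁ where
  field
    n      : ℕ
    E      : Fin n → Fin n → Set
    E?     : ∀ u v → Dec (E u v)
    sym    : ∀ {u v} → E u v → E v u
    irrefl : ∀ {v} → ¬ E v v

IsColoring : {V : Set} → (V → V → Set) → (k : ℕ) → (V → Fin k) → Set
IsColoring E k c = ∀ u v → E u v → c u ≢ c v

Colorable : {V : Set} → (V → V → Set) → ℕ → Set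
Colorable {V} E k = Σ (V → Fin k) (IsColoring E k)

IsChromaticNumber : {V : Set} → (V → V → Set) → ℕ → Set
IsChromaticNumber E k = Colorable E k × (∀ m → Colorable E m → k ≤ m)

PowV : FinGraph → Set → Set
PowV G I = I → Fin (FinGraph.n G)

PowE : (G : FinGraph) (I : Set) → PowV G I → PowV G I → Set
PowE G I u v = ∀ i → FinGraph.E G (u i) (v i)

IsTrivial : (G : FinGraph) (I : Set) (k : ℕ) → (PowV G I → Fin k) → Set
IsTrivial G I k Φ =
  Σ I λ i → Σ (Fin (FinGraph.n G) → Fin k) λ φ →
    IsColoring (FinGraph.E G) k φ × (∀ v → Φ v ≡ φ (v i))

TriviallyPowerColorable : FinGraph → Set
TriviallyPowerColorable G =
  ∀ m → ∀ k → IsChromaticNumber (PowE G (Fin (suc m))) k →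
    ∀ (Φ : PowV G (Fin (suc m)) → Fin k) →
      IsColoring (PowE G (Fin (suc m))) k Φ → IsTrivial G (Fin (suc m)) k Φ

-- subsets of I are represented as I → Bool
_⊆_ : {I : Set} → (I → Bool) → (I → Bool) → Set
A ⊆ B = ∀ i → A i ≡ true → B i ≡ true

record Ultrafilter (I : Set) : Set₁ where
  field
    Mem    : (I → Bool) → Set
    full   : Mem (λ _ → true)
    proper : ¬ Mem (λ _ → false)
    upward : ∀ {A B} → A ⊆ B → Mem A → Mem B
    meet   : ∀ {A B} → Mem A → Mem B → Mem (λ i → A i ∧ B i)
    ultra  : ∀ A → Mem A ⊎ Mem (λ i → not (A i))

-- v_U = w  iff  {α | v α = w} ∈ U
LimIs : {I : Set} (G : FinGraph) → Ultrafilter I → PowV G I → Fin (FinGraph.n G) → Set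
LimIs G U v w = Ultrafilter.Mem U (λ α → ⌊ v α ≟ w ⌋)

-- λ infinite cardinal: ℵ₀ ≤ |I|
Infinite : Set → Set
Infinite I = ℕ ↣ I

{-# OPTIONS --safe #-}
module Submission where

-- Let φ x (`diagonal`) be the colour Φ gives the constant vector x. For every finite
-- partition p of I, the colouring c ↦ Φ (c ∘ p) of a finite power of G is, by
-- trivial power-colourability, of the form c ↦ φ (c j) for one selected cell j.
-- Call A ⊆ I decisive when Φ of any vector that is x on A and y off A is φ x.
-- Applied to the partitions {A, ∁A} and {A∩B, A∖B, B∖A, ∁(A∪B)} this shows that
-- the decisive sets form an ultrafilter U, and applied to the partition of I by
-- the entries of v it shows Φ v = φ v_U. An edge uv of G guarantees φ u ≠ φ v,
-- which is what makes the selected cell unique and nonempty; if G has no edge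
-- then χ(G) ≤ 1 and any principal ultrafilter will do.

open import Defs
open import Data.Nat using (ℕ; zero; suc; _≤_; s≤s)
open import Data.Fin using (Fin; _≟_)
open import Data.Fin.Patterns using (0F)
open import Data.Fin.Properties using (any?; 2↔Bool; *↔×)
open import Data.Bool using (Bool; true; false; not; _∧_; if_then_else_)
open import Data.Product using (Σ; _×_; _,_; proj₁; proj₂; ∃)
open import Data.Product.Function.NonDependent.Propositional using (_×-↔_)
open import Data.Sum using (_⊎_; inj₁; inj₂)
open import Data.Empty using (⊥-elim)
open import Relation.Nullary using (¬_; does; yes; no; contradiction)
open import Relation.Nullary.Decidable using (⌊_⌋; dec-true; dec-false)
open import Relation.Binary.PropositionalEquality
  using (_≡_; _≢_; _≗_; refl; sym; trans; cong; cong₂; subst)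
open import Function using (id; _∘_)
open import Function.Bundles using (Inverse; Injection; _↔_)
open import Function.Properties.Inverse using (↔-trans)

pow-chromaticNumber : (G : FinGraph) {J : Set} → J → ∀ {k} →
  IsChromaticNumber (FinGraph.E G) k → IsChromaticNumber (PowE G J) k
pow-chromaticNumber G j ((c , c-coloring) , minimal) =
  ((λ v → c (v j)) , λ v w vw → c-coloring _ _ (vw j)) ,
  λ m (d , d-coloring) →
    minimal m ((λ x → d (λ _ → x)) , λ x y xy → d-coloring _ _ (λ _ → xy))

edgeless-chromaticNumber≤1 : (G : FinGraph) → (∀ u v → ¬ FinGraph.E G u v) →
  ∀ {k} → IsChromaticNumber (FinGraph.E G) k → k ≤ 1
edgeless-chromaticNumber≤1 G no-edge (_ , minimal) =
  minimal 1 ((λ _ → 0F) , λ u v uv → contradiction uv (no-edge u v))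

Fin≤1-unique : ∀ {k} → k ≤ 1 → (a b : Fin k) → a ≡ b
Fin≤1-unique {suc zero} _ 0F 0F = refl
Fin≤1-unique {suc (suc _)} (s≤s ()) _ _

principal : {I : Set} → I → Ultrafilter I
principal i = record
  { Mem    = λ A → A i ≡ true
  ; full   = refl
  ; proper = λ ()
  ; upward = λ A⊆B i∈A → A⊆B i i∈A
  ; meet   = λ i∈A i∈B → cong₂ _∧_ i∈A i∈B
  ; ultra  = λ A → decide (A i)
  }
  where
  decide : ∀ b → b ≡ true ⊎ not b ≡ true
  decide true  = inj₁ refl
  decide false = inj₂ refl

module PowerColoring (G : FinGraph) (tpc : TriviallyPowerColorable G) {I : Set} {k : ℕ}
         (χ[G]≡k : IsChromaticNumber (FinGraph.E G) k)
         (Φ : PowV G I → Fin k) (Φ-coloring : IsColoring (PowE G I) k Φ) where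
  open FinGraph G renaming (sym to E-sym)

  diagonal : Fin n → Fin k
  diagonal x = Φ (λ _ → x)

  diagonal-coloring : IsColoring E k diagonal
  diagonal-coloring x y xy = Φ-coloring _ _ (λ _ → xy)

  Selects : {J : Set} → (I → J) → J → Set
  Selects p j = ∀ (c : _ → Fin n) → Φ (c ∘ p) ≡ diagonal (c j)

  selects-fin : ∀ {N} → Fin N → (p : I → Fin N) → ∃ (Selects p)
  selects-fin {suc m} _ p
    with tpc m k (pow-chromaticNumber G 0F χ[G]≡k) (λ c → Φ (c ∘ p))
             (λ c d cd → Φ-coloring _ _ (cd ∘ p))
  ... | j , _ , _ , Φ∘p≡ψ = j , λ c → trans (Φ∘p≡ψ c) (sym (Φ∘p≡ψ (λ _ → c j)))

  piecewise : {J : Set} → (J → Bool) → Fin n → Fin n → J → Fin n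
  piecewise A x y j = if A j then x else y

  Decisive : (I → Bool) → Set
  Decisive A = ∀ x y → Φ (piecewise A x y) ≡ diagonal x

  selected-colour : ∀ {J} {p : I → J} {j} → Selects p j → (a : J → Bool) → ∀ {b} → a j ≡ b →
    ∀ x y → Φ (piecewise (a ∘ p) x y) ≡ diagonal (if b then x else y)
  selected-colour sel a aj≡b x y =
    trans (sel (piecewise a x y)) (cong (λ b → diagonal (if b then x else y)) aj≡b)

  selected⇒decisive : ∀ {J} {p : I → J} {j} → Selects p j → (a : J → Bool) →
    a j ≡ true → Decisive (a ∘ p)
  selected⇒decisive sel a = selected-colour sel a

  module _ {u v : Fin n} (uv : E u v) where

    diagonal-u≢v : diagonal u ≢ diagonal v
    diagonal-u≢v = diagonal-coloring u v uv

    swap-adjacent : ∀ b → E (if b then v else u) (if b then u else v)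
    swap-adjacent true  = E-sym uv
    swap-adjacent false = uv

    -- Φ need not respect pointwise equality a priori (no function extensionality).
    Φ-cong : ∀ {X Y} → X ≗ Y → Φ X ≡ Φ Y
    Φ-cong {X} {Y} X≗Y with selects-fin u X | selects-fin u Y
    ... | i , sel-X | j , sel-Y =
      trans (sel-X id) (trans (cong diagonal i≡j) (sym (sel-Y id)))
      where
      is-j : Fin n → Bool
      is-j l = does (l ≟ j)
      -- If i ≢ j, colouring the cell j by v in X and by u in Y, and the other cells the
      -- other way round, gives two adjacent vectors that both have colour diagonal u.
      i≡j : i ≡ j
      i≡j with i ≟ j
      ... | yes i≡j = i≡j
      ... | no i≢j = contradiction
          (trans (selected-colour sel-X is-j (dec-false (i ≟ j) i≢j) v u)
                 (sym (selected-colour sel-Y is-j (dec-true (j ≟ j) refl) u v)))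
          (Φ-coloring _ _ λ α → subst (λ l → E (piecewise is-j v u (X α)) (piecewise is-j u v l))
                                      (X≗Y α) (swap-adjacent (is-j (X α))))

    selects : ∀ {m} {J : Set} → Fin (suc m) ↔ J → (p : I → J) → ∃ (Selects p)
    selects F p =
      let j , sel = selects-fin 0F (from ∘ p) in
      to j , λ c → trans (Φ-cong λ α → cong c (sym (strictlyInverseˡ (p α)))) (sel (c ∘ to))
      where open Inverse F

    decisive⇒selected : ∀ {J} {p : I → J} {j} → Selects p j → (a : J → Bool) →
      Decisive (a ∘ p) → a j ≡ true
    decisive⇒selected {j = j} sel a decisive with a j in aj
    ... | true  = refl
    ... | false =
      contradiction (trans (sym (decisive u v)) (selected-colour sel a aj u v)) diagonal-u≢v

    decisive-nonempty : ∀ {A} → Decisive A → ¬ (∀ α → A α ≡ false)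
    decisive-nonempty decisive empty =
      diagonal-u≢v (trans (sym (decisive u v))
                          (Φ-cong λ α → cong (λ b → if b then u else v) (empty α)))

    decisive-or-not : ∀ A → Decisive A ⊎ Decisive (not ∘ A)
    decisive-or-not A with selects 2↔Bool A
    ... | true  , sel = inj₁ (selected⇒decisive sel id refl)
    ... | false , sel = inj₂ (selected⇒decisive sel not refl)

    decisive-∧ : ∀ {A B} → Decisive A → Decisive B → Decisive (λ α → A α ∧ B α)
    decisive-∧ {A} {B} decisive-A decisive-B
      with selects (↔-trans *↔× (2↔Bool ×-↔ 2↔Bool)) (λ α → A α , B α)
    ... | _ , sel = selected⇒decisive sel (λ ab → proj₁ ab ∧ proj₂ ab)
      (cong₂ _∧_ (decisive⇒selected sel proj₁ decisive-A)
                 (decisive⇒selected sel proj₂ decisive-B))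

    ⊆⇒∧-not-false : ∀ {A B : I → Bool} → A ⊆ B → ∀ α → A α ∧ not (B α) ≡ false
    ⊆⇒∧-not-false {A} A⊆B α with A α in α∈A
    ... | false = refl
    ... | true rewrite A⊆B α α∈A = refl

    decisive-upward : ∀ {A B} → A ⊆ B → Decisive A → Decisive B
    decisive-upward {B = B} A⊆B decisive-A with decisive-or-not B
    ... | inj₁ decisive-B  = decisive-B
    ... | inj₂ decisive-∁B =
      ⊥-elim (decisive-nonempty (decisive-∧ decisive-A decisive-∁B) (⊆⇒∧-not-false A⊆B))

    decisiveUltrafilter : Ultrafilter I
    decisiveUltrafilter = record
      { Mem    = Decisive
      ; full   = λ _ _ → refl
      ; proper = λ decisive → decisive-nonempty decisive (λ _ → refl)
      ; upward = decisive-upward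
      ; meet   = decisive-∧
      ; ultra  = decisive-or-not
      }

    Φ≡diagonal-limit : ∀ w z → LimIs G decisiveUltrafilter w z → Φ w ≡ diagonal z
    Φ≡diagonal-limit w z w→z with selects-fin z w
    ... | j , sel = trans (sel id) (cong diagonal j≡z)
      where
      j≡z : j ≡ z
      j≡z with j ≟ z | decisive⇒selected sel (λ l → ⌊ l ≟ z ⌋) w→z
      ... | yes j≡z | _ = j≡z
      ... | no _    | ()

mainTheorem3 : (G : FinGraph) → TriviallyPowerColorable G →
    (I : Set) → Infinite I →
    (k : ℕ) → IsChromaticNumber (FinGraph.E G) k →
    (Φ : PowV G I → Fin k) → IsColoring (PowE G I) k Φ →
    Σ (Ultrafilter I) λ U → Σ (Fin (FinGraph.n G) → Fin k) λ φ →
    IsColoring (FinGraph.E G) k φ ×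
    (∀ v w → LimIs G U v w → Φ v ≡ φ w)
mainTheorem3 G tpc I infinite k χ[G]≡k Φ Φ-coloring
  with any? (λ u → any? (λ v → FinGraph.E? G u v))
... | yes (u , v , uv) =
  decisiveUltrafilter uv , diagonal , diagonal-coloring , Φ≡diagonal-limit uv
  where open PowerColoring G tpc χ[G]≡k Φ Φ-coloring
... | no no-edge =
  principal (Injection.to infinite 0) , proj₁ (proj₁ χ[G]≡k) , proj₂ (proj₁ χ[G]≡k) ,
  λ _ _ _ → Fin≤1-unique k≤1 _ _
  where
  k≤1 : k ≤ 1
  k≤1 = edgeless-chromaticNumber≤1 G (λ u v uv → no-edge (u , v , uv)) χ[G]≡k
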